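{- Let $n$ be an odd positive integer, and define functions $\pi_1,\pi_2,\pi_3,\pi_4$ on $[n]=\{1,\dotsc,n\}$ by $\pi_1(i)=i$, $\pi_4(i)=n+1-i$, $\pi_3(i)=(i+1)/2$ for odd $i$ and $\pi_3(i)=i/2+(n+1)/2$ for even $i$, and $\pi_2(i)=n+1-\pi_3(i)$. With indices taken modulo $n$ (so $\pi_j(n+1)=\pi_j(1)$), define for $i\in[n]$ \[\varphi_1^i=\pi_1(i)+\pi_1(i+1)+\pi_2(i)+\pi_2(i+1)+\pi_4(i)+\tfrac{n+1}{2}-1,\] \[\varphi_2^i=\pi_1(i)+3\pi_2(i)+\pi_3(i)+\begin{cases}n & i\text{ even},\\ 0 & i\text{ odd}.\end{cases}\] Then $\pi_1,\dotsc,\pi_4$ are permutations of $[n]$ and $\varphi_1^i=\varphi_2^i=3n+2$ for every $i\in[n]$. -}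

module Defs where

open import Data.Nat using (ℕ; zero; suc; _+_; _*_; _∸_; _≤_; _%_; ⌊_/2⌋)
open import Data.Nat.Properties using (_≟_)
open import Data.Product using (_×_; ∃-syntax)
open import Relation.Binary.PropositionalEquality using (_≡_)
open import Relation.Nullary using (yes; no)

InRange : ℕ → ℕ → Set
InRange n i = 1 ≤ i × i ≤ n

IsPermutationOf : ℕ → (ℕ → ℕ) → Set
IsPermutationOf n f =
    (∀ i → InRange n i → InRange n (f i))
  × (∀ i j → InRange n i → InRange n j → f i ≡ f j → i ≡ j)
  × (∀ j → InRange n j → ∃[ i ] (InRange n i × f i ≡ j))

nextMod : ℕ → ℕ → ℕ
nextMod n i with i ≟ n
... | yes _ = 1
... | no _  = suc i

π₁ : ℕ → ℕ → ℕ
π₁ n i = i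

π₄ : ℕ → ℕ → ℕ
π₄ n i = (n + 1) ∸ i

π₃ : ℕ → ℕ → ℕ
π₃ n i with i % 2 ≟ 1
... | yes _ = ⌊ i + 1 /2⌋
... | no _  = ⌊ i /2⌋ + ⌊ n + 1 /2⌋

π₂ : ℕ → ℕ → ℕ
π₂ n i = (n + 1) ∸ π₃ n i

φ₁ : ℕ → ℕ → ℕ
φ₁ n i = π₁ n i + π₁ n (nextMod n i) + π₂ n i + π₂ n (nextMod n i) + π₄ n i
         + ⌊ n + 1 /2⌋ ∸ 1

φ₂ : ℕ → ℕ → ℕ
φ₂ n i = π₁ n i + 3 * π₂ n i + π₃ n i + extra
  where
  extra : ℕ
  extra with i % 2 ≟ 0
  ... | yes _ = n
  ... | no _  = 0

-- Write n = 2m + 1 and an index of [n] as i = 2k + 1 (k ≤ m) or i = 2k + 2 (k < m). Then π₃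
-- maps the odd indices increasingly onto 1, …, m + 1 and the even ones onto m + 2, …, n, so it is
-- a bijection; π₄ is an involution and π₂ = π₄ ∘ π₃. On each kind of index every πⱼ, hence also
-- φ₁ and φ₂, is an explicit linear expression in k and m, and φ₁ = φ₂ = 3n + 2 is a ring identity.
-- The only wrap-around, i = n with i + 1 read as 1, is a separate case for φ₁.

module Submission where

open import Defs
open import Data.Nat using (ℕ; zero; suc; _+_; _*_; _∸_; _%_; _≤_; _<_; z≤n; s≤s; z<s; ⌊_/2⌋)
open import Data.Nat.Properties
open import Data.Nat.Tactic.RingSolver using (solve)
open import Data.List using ([]; _∷_)
open import Data.Product using (_×_; _,_; ∃-syntax)
open import Function using (_∘_)
open import Relation.Nullary using (yes; no)
open import Relation.Nullary.Negation using (contradiction)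
open import Relation.Binary.PropositionalEquality
open ≡-Reasoning

isPermutationOf-id : ∀ n → IsPermutationOf n (λ i → i)
isPermutationOf-id n = (λ _ i∈[n] → i∈[n]) , (λ _ _ _ _ i≡j → i≡j) , λ j j∈[n] → j , j∈[n] , refl

isPermutationOf-∘ : ∀ {n f g} → IsPermutationOf n f → IsPermutationOf n g → IsPermutationOf n (f ∘ g)
isPermutationOf-∘ {f = f} (f-into , f-inj , f-onto) (g-into , g-inj , g-onto) =
    (λ i i∈[n] → f-into _ (g-into i i∈[n]))
  , (λ i j i∈[n] j∈[n] → g-inj i j i∈[n] j∈[n] ∘ f-inj _ _ (g-into i i∈[n]) (g-into j j∈[n]))
  , λ k k∈[n] → let j , j∈[n] , fj≡k = f-onto k k∈[n] ; i , i∈[n] , gi≡j = g-onto j j∈[n]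
                in i , i∈[n] , trans (cong f gi≡j) fj≡k

involution⇒isPermutationOf : ∀ {n f} → (∀ i → InRange n i → InRange n (f i)) →
                             (∀ i → InRange n i → f (f i) ≡ i) → IsPermutationOf n f
involution⇒isPermutationOf {f = f} f-into f∘f≡id =
    f-into
  , (λ i j i∈[n] j∈[n] fi≡fj → trans (sym (f∘f≡id i i∈[n])) (trans (cong f fi≡fj) (f∘f≡id j j∈[n])))
  , λ j j∈[n] → f j , f-into j j∈[n] , f∘f≡id j j∈[n]

data Parity : ℕ → Set where
  even : ∀ k → Parity (k + k)
  odd  : ∀ k → Parity (suc (k + k))

parity : ∀ i → Parity i
parity zero = even 0
parity (suc i) with parity i
... | even k = odd k
... | odd k  = subst Parity (cong suc (+-suc k k)) (even (suc k))

[k+k]%2≡0 : ∀ k → (k + k) % 2 ≡ 0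
[k+k]%2≡0 zero    = refl
[k+k]%2≡0 (suc k) rewrite +-suc k k = [k+k]%2≡0 k

[1+k+k]%2≡1 : ∀ k → suc (k + k) % 2 ≡ 1
[1+k+k]%2≡1 zero    = refl
[1+k+k]%2≡1 (suc k) rewrite +-suc k k = [1+k+k]%2≡1 k

⌊1+k+k+1/2⌋≡1+k : ∀ k → ⌊ suc (k + k) + 1 /2⌋ ≡ suc k
⌊1+k+k+1/2⌋≡1+k k rewrite +-comm (suc (k + k)) 1 = cong suc (sym (n≡⌊n+n/2⌋ k))

k+k≤1+m+m⇒k≤m : ∀ {k m} → k + k ≤ suc (m + m) → k ≤ m
k+k≤1+m+m⇒k≤m {k} {m} k+k≤1+m+m = ≮⇒≥ λ m<k →
  <⇒≱ (subst (_≤ k + k) (cong suc (+-suc m m)) (+-mono-≤ m<k m<k)) k+k≤1+m+m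

-- The slack d (with k + d = m, resp. 1 + k + d = m) keeps every closed form below free of
-- truncated subtraction, so each identity is a polynomial one once m is replaced by k + d.
data Position (m : ℕ) : ℕ → Set where
  odd  : ∀ k d → k + d ≡ m → Position m (suc (k + k))
  even : ∀ k d → suc k + d ≡ m → Position m (suc k + suc k)

position : ∀ m {i} → InRange (suc (m + m)) i → Position m i
position m {i} (1≤i , i≤n) with parity i
... | odd k        = let d , k+d≡m = m≤n⇒∃[o]m+o≡n (k+k≤1+m+m⇒k≤m {k} {m} (<⇒≤ i≤n)) in odd k d k+d≡m
... | even (suc k) = let d , 1+k+d≡m = m≤n⇒∃[o]m+o≡n (k+k≤1+m+m⇒k≤m {suc k} {m} i≤n) in even k d 1+k+d≡m
... | even zero    = contradiction 1≤i λ ()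

nextMod-≡ : ∀ {n i} → i ≡ n → nextMod n i ≡ 1
nextMod-≡ {n} {i} i≡n with i ≟ n
... | yes _  = refl
... | no i≢n = contradiction i≡n i≢n

nextMod-< : ∀ {n i} → i < n → nextMod n i ≡ suc i
nextMod-< {n} {i} i<n with i ≟ n
... | yes i≡n = contradiction i≡n (<⇒≢ i<n)
... | no _    = refl

π₃-odd : ∀ n k → π₃ n (suc (k + k)) ≡ suc k
π₃-odd n k with suc (k + k) % 2 ≟ 1
... | yes _ = ⌊1+k+k+1/2⌋≡1+k k
... | no ≢1 = contradiction ([1+k+k]%2≡1 k) ≢1

π₃-even : ∀ m k → π₃ (suc (m + m)) (k + k) ≡ k + suc m
π₃-even m k with (k + k) % 2 ≟ 1
... | yes ≡1 = contradiction (trans (sym ([k+k]%2≡0 k)) ≡1) 0≢1+n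
... | no _   = cong₂ _+_ (sym (n≡⌊n+n/2⌋ k)) (⌊1+k+k+1/2⌋≡1+k m)

π₄-≡ : ∀ n i c → i + c ≡ n + 1 → π₄ n i ≡ c
π₄-≡ n i c i+c≡n+1 = trans (cong (_∸ i) (sym i+c≡n+1)) (m+n∸m≡n i c)

π₄-odd : ∀ {m} k d → k + d ≡ m → π₄ (suc (m + m)) (suc (k + k)) ≡ suc (d + d)
π₄-odd k d refl = π₄-≡ (suc (k + d + (k + d))) (suc (k + k)) (suc (d + d)) (solve (k ∷ d ∷ []))

π₄-even : ∀ {m} k d → suc k + d ≡ m → π₄ (suc (m + m)) (suc k + suc k) ≡ suc d + suc d
π₄-even k d refl = π₄-≡ (suc (suc k + d + (suc k + d))) (suc k + suc k) (suc d + suc d) (solve (k ∷ d ∷ []))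

π₂-odd : ∀ {m} k d → k + d ≡ m → π₂ (suc (m + m)) (suc (k + k)) ≡ suc (k + d + d)
π₂-odd {m} k d refl = begin
  π₄ n (π₃ n (suc (k + k)))  ≡⟨ cong (π₄ n) (π₃-odd n k) ⟩
  π₄ n (suc k)
    ≡⟨ π₄-≡ (suc (k + d + (k + d))) (suc k) (suc (k + d + d)) (solve (k ∷ d ∷ [])) ⟩
  suc (k + d + d)            ∎
  where n = suc (m + m)

π₂-even : ∀ {m} k d → suc k + d ≡ m → π₂ (suc (m + m)) (suc k + suc k) ≡ suc d
π₂-even {m} k d refl = begin
  π₄ n (π₃ n (suc k + suc k))  ≡⟨ cong (π₄ n) (π₃-even m (suc k)) ⟩
  π₄ n (suc k + suc m)
    ≡⟨ π₄-≡ (suc (suc k + d + (suc k + d))) (suc k + suc (suc k + d)) (suc d) (solve (k ∷ d ∷ [])) ⟩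
  suc d                        ∎
  where n = suc (m + m)

-- Writing ⌊(n + 1)/2⌋ as 1 + h absorbs the truncated "- 1" at the end of φ₁.
φ₁-≡ : ∀ {n i j a b c h} → nextMod n i ≡ j → π₂ n i ≡ a → π₂ n j ≡ b → π₄ n i ≡ c →
       ⌊ n + 1 /2⌋ ≡ suc h → φ₁ n i ≡ i + j + a + b + c + h
φ₁-≡ {i = i} {j} {a} {b} {c} {h} refl refl refl refl ⌊n+1/2⌋≡1+h =
  cong (_∸ 1) (trans (cong (s +_) ⌊n+1/2⌋≡1+h) (+-suc s h))
  where s = i + j + a + b + c

φ₂-odd-≡ : ∀ {n k a} → π₂ n (suc (k + k)) ≡ a → φ₂ n (suc (k + k)) ≡ suc (k + k) + 3 * a + suc k
φ₂-odd-≡ {n} {k} refl with suc (k + k) % 2 ≟ 0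
... | yes ≡0 = contradiction (trans (sym ≡0) ([1+k+k]%2≡1 k)) 0≢1+n
... | no _   = trans (+-identityʳ _) (cong (suc (k + k) + 3 * π₂ n (suc (k + k)) +_) (π₃-odd n k))

φ₂-even-≡ : ∀ {m k a} → π₂ (suc (m + m)) (k + k) ≡ a →
            φ₂ (suc (m + m)) (k + k) ≡ k + k + 3 * a + (k + suc m) + suc (m + m)
φ₂-even-≡ {m} {k} refl with (k + k) % 2 ≟ 0
... | yes _ = cong (λ b → k + k + 3 * π₂ (suc (m + m)) (k + k) + b + suc (m + m)) (π₃-even m k)
... | no ≢0 = contradiction ([k+k]%2≡0 k) ≢0

φ₁-last≡3n+2 : ∀ {m} k → k + 0 ≡ m → φ₁ (suc (m + m)) (suc (k + k)) ≡ 3 * suc (m + m) + 2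
φ₁-last≡3n+2 k refl = begin
  φ₁ (suc (k + 0 + (k + 0))) (suc (k + k))
    ≡⟨ φ₁-≡ (nextMod-≡ (cong (λ x → suc (x + x)) (sym (+-identityʳ k))))
            (π₂-odd k 0 refl) (π₂-odd 0 (k + 0) refl) (π₄-odd k 0 refl) (⌊1+k+k+1/2⌋≡1+k (k + 0)) ⟩
  suc (k + k) + 1 + suc (k + 0 + 0) + suc (k + 0 + (k + 0)) + suc (0 + 0) + (k + 0)
    ≡⟨ solve (k ∷ []) ⟩
  3 * suc (k + 0 + (k + 0)) + 2 ∎

φ₁-odd≡3n+2 : ∀ {m} k d → k + suc d ≡ m → φ₁ (suc (m + m)) (suc (k + k)) ≡ 3 * suc (m + m) + 2
φ₁-odd≡3n+2 k d refl = begin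
  φ₁ (suc (k + suc d + (k + suc d))) (suc (k + k))
    ≡⟨ φ₁-≡ (trans (nextMod-< (s≤s (+-mono-< k<m k<m))) (cong suc (sym (+-suc k k))))
            (π₂-odd k (suc d) refl) (π₂-even k d (sym (+-suc k d))) (π₄-odd k (suc d) refl)
            (⌊1+k+k+1/2⌋≡1+k (k + suc d)) ⟩
  suc (k + k) + (suc k + suc k) + suc (k + suc d + suc d) + suc d + suc (suc d + suc d) + (k + suc d)
    ≡⟨ solve (k ∷ d ∷ []) ⟩
  3 * suc (k + suc d + (k + suc d)) + 2 ∎
  where k<m = m<m+n k {suc d} z<s

φ₁-even≡3n+2 : ∀ {m} k d → suc k + d ≡ m → φ₁ (suc (m + m)) (suc k + suc k) ≡ 3 * suc (m + m) + 2
φ₁-even≡3n+2 k d refl = begin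
  φ₁ (suc (suc k + d + (suc k + d))) (suc k + suc k)
    ≡⟨ φ₁-≡ (nextMod-< (s≤s (+-mono-≤ 1+k≤m 1+k≤m)))
            (π₂-even k d refl) (π₂-odd (suc k) d refl) (π₄-even k d refl)
            (⌊1+k+k+1/2⌋≡1+k (suc k + d)) ⟩
  suc k + suc k + suc (suc k + suc k) + suc d + suc (suc k + d + d) + (suc d + suc d) + (suc k + d)
    ≡⟨ solve (k ∷ d ∷ []) ⟩
  3 * suc (suc k + d + (suc k + d)) + 2 ∎
  where 1+k≤m = m≤m+n (suc k) d

φ₂-odd≡3n+2 : ∀ {m} k d → k + d ≡ m → φ₂ (suc (m + m)) (suc (k + k)) ≡ 3 * suc (m + m) + 2
φ₂-odd≡3n+2 k d refl = begin
  φ₂ (suc (k + d + (k + d))) (suc (k + k))  ≡⟨ φ₂-odd-≡ (π₂-odd k d refl) ⟩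
  suc (k + k) + 3 * suc (k + d + d) + suc k  ≡⟨ solve (k ∷ d ∷ []) ⟩
  3 * suc (k + d + (k + d)) + 2              ∎

φ₂-even≡3n+2 : ∀ {m} k d → suc k + d ≡ m → φ₂ (suc (m + m)) (suc k + suc k) ≡ 3 * suc (m + m) + 2
φ₂-even≡3n+2 k d refl = begin
  φ₂ (suc (suc k + d + (suc k + d))) (suc k + suc k)
    ≡⟨ φ₂-even-≡ {k = suc k} (π₂-even k d refl) ⟩
  suc k + suc k + 3 * suc d + (suc k + suc (suc k + d)) + suc (suc k + d + (suc k + d))
    ≡⟨ solve (k ∷ d ∷ []) ⟩
  3 * suc (suc k + d + (suc k + d)) + 2 ∎

φ₁≡φ₂≡3n+2 : ∀ m i → InRange (suc (m + m)) i →
             φ₁ (suc (m + m)) i ≡ 3 * suc (m + m) + 2 × φ₂ (suc (m + m)) i ≡ 3 * suc (m + m) + 2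
φ₁≡φ₂≡3n+2 m i i∈[n] with position m i∈[n]
... | odd k zero    k+0≡m   = φ₁-last≡3n+2 k k+0≡m , φ₂-odd≡3n+2 k 0 k+0≡m
... | odd k (suc d) k+d≡m   = φ₁-odd≡3n+2 k d k+d≡m , φ₂-odd≡3n+2 k (suc d) k+d≡m
... | even k d      1+k+d≡m = φ₁-even≡3n+2 k d 1+k+d≡m , φ₂-even≡3n+2 k d 1+k+d≡m

π₄-inRange : ∀ n i → InRange n i → InRange n (π₄ n i)
π₄-inRange n i (1≤i , i≤n) =
  m<n⇒0<n∸m (≤-<-trans i≤n (m<m+n n z<s)) , subst (π₄ n i ≤_) (m+n∸n≡m n 1) (∸-monoʳ-≤ (n + 1) 1≤i)

π₄-involutive : ∀ n i → InRange n i → π₄ n (π₄ n i) ≡ i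
π₄-involutive n i (_ , i≤n) = m∸[m∸n]≡n (m≤n⇒m≤n+o 1 i≤n)

isPermutationOf-π₄ : ∀ n → IsPermutationOf n (π₄ n)
isPermutationOf-π₄ n = involution⇒isPermutationOf (π₄-inRange n) (π₄-involutive n)

π₃-inRange : ∀ m i → InRange (suc (m + m)) i → InRange (suc (m + m)) (π₃ (suc (m + m)) i)
π₃-inRange m i i∈[n] with position m i∈[n]
... | odd k d refl  = subst (InRange (suc (m + m))) (sym (π₃-odd (suc (m + m)) k))
                        (s≤s z≤n , s≤s (≤-trans (m≤m+n k d) (m≤m+n m m)))
... | even k d refl = subst (InRange (suc (m + m))) (sym (π₃-even m (suc k)))
                        (s≤s z≤n , subst (suc k + suc m ≤_) (+-suc m m)
                                            (+-monoˡ-≤ (suc m) (m≤m+n (suc k) d)))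

π₃-odd<π₃-even : ∀ {m} k d k′ → k + d ≡ m →
                 π₃ (suc (m + m)) (suc (k + k)) < π₃ (suc (m + m)) (suc k′ + suc k′)
π₃-odd<π₃-even {m} k d k′ refl =
  subst₂ _<_ (sym (π₃-odd (suc (m + m)) k)) (sym (π₃-even m (suc k′)))
    (s≤s (≤-trans (s≤s (m≤m+n k d)) (m≤n+m (suc m) k′)))

π₃-injective : ∀ m i j → InRange (suc (m + m)) i → InRange (suc (m + m)) j →
               π₃ (suc (m + m)) i ≡ π₃ (suc (m + m)) j → i ≡ j
π₃-injective m i j i∈[n] j∈[n] π₃i≡π₃j with position m i∈[n] | position m j∈[n]
... | odd k _ _ | odd k′ _ _ = cong (λ t → suc (t + t)) (suc-injective (begin
  suc k                            ≡⟨ π₃-odd (suc (m + m)) k ⟨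
  π₃ (suc (m + m)) (suc (k + k))   ≡⟨ π₃i≡π₃j ⟩
  π₃ (suc (m + m)) (suc (k′ + k′)) ≡⟨ π₃-odd (suc (m + m)) k′ ⟩
  suc k′                           ∎))
... | even k _ _ | even k′ _ _ = cong (λ t → t + t) (+-cancelʳ-≡ (suc m) (suc k) (suc k′) (begin
  suc k + suc m                      ≡⟨ π₃-even m (suc k) ⟨
  π₃ (suc (m + m)) (suc k + suc k)   ≡⟨ π₃i≡π₃j ⟩
  π₃ (suc (m + m)) (suc k′ + suc k′) ≡⟨ π₃-even m (suc k′) ⟩
  suc k′ + suc m                     ∎))
... | odd k d k+d≡m | even k′ _ _ = contradiction π₃i≡π₃j (<⇒≢ (π₃-odd<π₃-even k d k′ k+d≡m))
... | even k _ _ | odd k′ d′ k′+d′≡m = contradiction (sym π₃i≡π₃j) (<⇒≢ (π₃-odd<π₃-even k′ d′ k k′+d′≡m))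

π₃-surjective : ∀ m j → InRange (suc (m + m)) j →
                ∃[ i ] (InRange (suc (m + m)) i × π₃ (suc (m + m)) i ≡ j)
π₃-surjective m zero    (() , _)
π₃-surjective m (suc k) (_ , 1+k≤n) with k ≤? m
... | yes k≤m = suc (k + k) , (s≤s z≤n , s≤s (+-mono-≤ k≤m k≤m)) , π₃-odd (suc (m + m)) k
... | no k≰m  with m≤n⇒∃[o]m+o≡n (≰⇒> k≰m)
...   | t , 1+m+t≡k = suc t + suc t , (s≤s z≤n , ≤-trans (+-mono-≤ 1+t≤m 1+t≤m) (n≤1+n (m + m)))
                    , trans (π₃-even m (suc t)) (cong suc (trans (+-comm t (suc m)) 1+m+t≡k))
  where
  1+t≤m : suc t ≤ m
  1+t≤m = +-cancelˡ-≤ m (suc t) m (subst (_≤ m + m) (sym (trans (+-suc m t) 1+m+t≡k)) (≤-pred 1+k≤n))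

isPermutationOf-π₃ : ∀ m → IsPermutationOf (suc (m + m)) (π₃ (suc (m + m)))
isPermutationOf-π₃ m = π₃-inRange m , π₃-injective m , π₃-surjective m

lemma4p2 : (n : ℕ) → n % 2 ≡ 1 →
    (IsPermutationOf n (π₁ n) × IsPermutationOf n (π₂ n)
      × IsPermutationOf n (π₃ n) × IsPermutationOf n (π₄ n))
    × (∀ i → InRange n i → φ₁ n i ≡ 3 * n + 2 × φ₂ n i ≡ 3 * n + 2)
lemma4p2 n n%2≡1 with parity n
... | even k = contradiction (trans (sym ([k+k]%2≡0 k)) n%2≡1) 0≢1+n
... | odd m  =
  ( isPermutationOf-id n
  , isPermutationOf-∘ (isPermutationOf-π₄ n) (isPermutationOf-π₃ m)
  , isPermutationOf-π₃ m
  , isPermutationOf-π₄ n )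
  , φ₁≡φ₂≡3n+2 m
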